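{- Let $G=(I\cup K,E)$ be a connected split graph, where $K$ is a clique of $G$, $I$ is a maximal independent set of $G$, and $I\cap K=\emptyset$. Let $I^{(1)}\subseteq I$ be the set of vertices of $I$ of degree $1$ in $G$, and let $K^{(1)}=N_G(I^{(1)})$. Suppose that $K^{(1)}=K$ and $|K|\ge 2$. Let $\hat G$ be the bipartite graph obtained from $G$ by removing all edges between vertices of $K$. Then $G$ has a spanning even tree if and only if $\hat G$ is connected.
   Context: All graphs are finite and simple. A split graph is a graph whose vertex set can be partitioned into a clique and an independent set. For $X\subseteq V$, $N_G(X)=\bigcup_{v\in X}N_G(v)\setminus X$, where $N_G(v)$ is the set of neighbors of $v$. A leaf of a tree is a vertex of degree $1$. A tree is even if for every pair of distinct leaves, the number of edges of the unique path between them is even. A spanning even tree of $G$ is a spanning tree of $G$ that is even. -}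

module Defs where

open import Data.Nat using (ℕ; zero; suc; _+_; _≤_; _%_)
open import Data.Bool using (Bool; true; false; _∧_; not)
open import Data.Fin using (Fin)
open import Data.List using (List; []; _∷_; length; filterᵇ; allFin)
open import Data.List.Relation.Unary.Unique.Propositional using (Unique)
open import Data.Product using (Σ; _×_; ∃; ∃-syntax)
open import Relation.Binary.PropositionalEquality using (_≡_; _≢_)
open import Relation.Nullary using (¬_)

Adjacency : ℕ → Set
Adjacency n = Fin n → Fin n → Bool

module _ {n : ℕ} where

  IsSimpleGraph : Adjacency n → Set
  IsSimpleGraph A = (∀ u v → A u v ≡ A v u) × (∀ u → A u u ≡ false)

  neighbours : Adjacency n → Fin n → List (Fin n)
  neighbours A u = filterᵇ (A u) (allFin n)

  degree : Adjacency n → Fin n → ℕ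
  degree A u = length (neighbours A u)

  data Walk (A : Adjacency n) : Fin n → Fin n → Set where
    []  : ∀ {u} → Walk A u u
    _∷_ : ∀ {u v w} → A u v ≡ true → Walk A v w → Walk A u w

  len : ∀ {A u v} → Walk A u v → ℕ
  len []       = 0
  len (_ ∷ p)  = suc (len p)

  support : ∀ {A u v} → Walk A u v → List (Fin n)
  support {u = u} []      = u ∷ []
  support {u = u} (_ ∷ p) = u ∷ support p

  IsPath : ∀ {A u v} → Walk A u v → Set
  IsPath p = Unique (support p)

  Connected : Adjacency n → Set
  Connected A = ∀ u v → Walk A u v

  HasCycle : Adjacency n → Set
  HasCycle A = ∃[ u ] ∃[ v ] Σ (Walk A v u) λ p →
                 IsPath p × (2 ≤ len p) × (A u v ≡ true)

  Acyclic : Adjacency n → Set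
  Acyclic A = ¬ HasCycle A

  IsTree : Adjacency n → Set
  IsTree T = IsSimpleGraph T × Connected T × Acyclic T

  SubgraphOf : Adjacency n → Adjacency n → Set
  SubgraphOf T G = ∀ u v → T u v ≡ true → G u v ≡ true

  Leaf : Adjacency n → Fin n → Set
  Leaf T u = degree T u ≡ 1

  IsEvenTree : Adjacency n → Set
  IsEvenTree T = IsTree T ×
    (∀ u v → u ≢ v → Leaf T u → Leaf T v →
       (p : Walk T u v) → IsPath p → len p % 2 ≡ 0)

  HasSpanningEvenTree : Adjacency n → Set
  HasSpanningEvenTree G = ∃[ T ] SubgraphOf T G × IsEvenTree T

  Clique : Adjacency n → (Fin n → Bool) → Set
  Clique G S = ∀ u v → S u ≡ true → S v ≡ true → u ≢ v → G u v ≡ true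

  Independent : Adjacency n → (Fin n → Bool) → Set
  Independent G S = ∀ u v → S u ≡ true → S v ≡ true → G u v ≡ false

  MaximalIndependent : Adjacency n → (Fin n → Bool) → Set
  MaximalIndependent G S = Independent G S ×
    (∀ v → S v ≡ false → ∃[ u ] S u ≡ true × G u v ≡ true)

  InNbhd : Adjacency n → (Fin n → Bool) → Fin n → Set
  InNbhd G X v = X v ≡ false × ∃[ u ] X u ≡ true × G u v ≡ true

  card : (Fin n → Bool) → ℕ
  card S = length (filterᵇ S (allFin n))

  removeKEdges : Adjacency n → (Fin n → Bool) → Adjacency n
  removeKEdges G inK u v = G u v ∧ not (inK u ∧ inK v)

-- Every vertex of K carries a pendant vertex of I, and a pendant edge lies in every
-- connected spanning subgraph. If Ĝ is connected, a spanning tree of Ĝ is bipartite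
-- between K and I, and since |K| ≥ 2 no vertex of K is a leaf (it is joined both to its
-- pendant vertex and, towards the rest of K, to something else); so all leaves lie in I
-- and all leaf-to-leaf paths are even. Conversely, an edge xy inside K in an even tree
-- would give the path l_x x y l_y of length 3 between the pendant leaves at x and y;
-- hence an even spanning tree is a spanning subgraph of Ĝ, and Ĝ is connected.
module Submission where

open import Defs
open import Data.Nat using (ℕ; zero; suc; _+_; _≤_; _<_; _%_; z≤n; s≤s)
open import Data.Nat.Base using (_≡ᵇ_)
open import Data.Nat.Properties
  using (≡ᵇ⇒≡; ≤-reflexive; <-irrefl; m≤m+n; +-identityʳ; +-suc; +-monoˡ-≤; +-comm; module ≤-Reasoning)
open import Data.Nat.Induction using (<-wellFounded)
open import Induction.WellFounded using (Acc; acc)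
open import Data.Bool using (Bool; true; false; not; _∧_; T?)
open import Data.Bool.Properties
  using (∨-comm; ∧-comm; not-involutive; not-injective; not-¬; T-≡) renaming (_≟_ to _≟ᵇ_)
open import Data.Fin using (Fin) renaming (_≟_ to _≟ᶠ_)
open import Data.Fin.Properties using (any?)
open import Data.List using (List; []; _∷_; length; filterᵇ; allFin; _∷ʳ_; reverse)
open import Data.List.Properties using (unfold-reverse)
open import Data.List.Membership.Propositional using (_∈_)
open import Data.List.Membership.Propositional.Properties using (∈-filter⁺; ∈-filter⁻; ∈-allFin)
open import Data.List.Relation.Unary.Any using (here; there)
open import Data.List.Relation.Unary.All as All using ([]; _∷_)
open import Data.List.Relation.Unary.AllPairs using ([]; _∷_)
open import Data.List.Relation.Unary.Unique.Propositional using (Unique)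
import Data.List.Relation.Unary.Unique.Propositional.Properties as Unique
import Data.List.Relation.Binary.Permutation.Setoid as Permutation
import Data.List.Relation.Binary.Permutation.Setoid.Properties as PermutationProperties
open import Data.Product using (_×_; _,_; ∃-syntax; proj₁; proj₂)
open import Data.Sum using (_⊎_; inj₁; inj₂)
open import Data.Empty using (⊥)
open import Function.Base using (_∘_)
open import Function.Bundles using (_⇔_; mk⇔; Equivalence)
open import Relation.Unary using (Decidable)
open import Relation.Nullary using (Dec; yes; no; does; ¬_; ¬?; contradiction; _×-dec_; _⊎-dec_)
open import Relation.Nullary.Decidable using (dec-true; dec-false)
open import Relation.Binary.PropositionalEquality
  using (_≡_; _≢_; refl; sym; trans; cong; cong₂; subst; setoid; module ≡-Reasoning)

private
  variable
    n : ℕ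

witness : {A : Set} (a? : Dec A) → does a? ≡ true → A
witness (yes a) _ = a

∧-true : ∀ {a b} → a ∧ b ≡ true → a ≡ true × b ≡ true
∧-true {true} {true} _ = refl , refl

least : {P : ℕ → Set} → Decidable P → ℕ → ℕ
least P? zero = zero
least P? (suc L) with P? zero
... | yes _ = zero
... | no  _ = suc (least (λ k → P? (suc k)) L)

least-satisfies : {P : ℕ → Set} (P? : Decidable P) (L : ℕ) → P L → P (least P? L)
least-satisfies P? zero    pL = pL
least-satisfies P? (suc L) pL with P? zero
... | yes p0 = p0
... | no  _  = least-satisfies (λ k → P? (suc k)) L pL

least-minimal : {P : ℕ → Set} (P? : Decidable P) (L : ℕ) {j : ℕ} → P j → least P? L ≤ j
least-minimal P? zero _ = z≤n
least-minimal P? (suc L) {j} pj with P? zero | j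
... | yes _   | _      = z≤n
... | no  ¬p0 | zero   = contradiction pj ¬p0
... | no  _   | suc _  = s≤s (least-minimal (λ k → P? (suc k)) L pj)

length≡1⇒members-equal : {A : Set} {a b : A} (xs : List A) → length xs ≡ 1 → a ∈ xs → b ∈ xs → a ≡ b
length≡1⇒members-equal (_ ∷ []) _ (here refl) (here refl) = refl
length≡1⇒members-equal (_ ∷ []) _ (here _)    (there ())
length≡1⇒members-equal (_ ∷ []) _ (there ())  _

Unique-constant⇒length≡1 : {A : Set} {k : A} (xs : List A) → Unique xs →
                           (∀ {w} → w ∈ xs → w ≡ k) → k ∈ xs → length xs ≡ 1
Unique-constant⇒length≡1 (_ ∷ [])    _                 _        _ = refl
Unique-constant⇒length≡1 (_ ∷ _ ∷ _) ((c≢d ∷ _) ∷ _) all≡k _ =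
  contradiction (trans (all≡k (here refl)) (sym (all≡k (there (here refl))))) c≢d

Unique-length≥2⇒∃≢ : (xs : List (Fin n)) → Unique xs → 2 ≤ length xs → ∀ v → ∃[ k ] k ∈ xs × k ≢ v
Unique-length≥2⇒∃≢ (_ ∷ []) _ (s≤s ()) _
Unique-length≥2⇒∃≢ (a ∷ b ∷ _) ((a≢b ∷ _) ∷ _) _ v with a ≟ᶠ v
... | yes refl = b , there (here refl) , λ b≡a → a≢b (sym b≡a)
... | no  a≢v  = a , here refl , a≢v

module _ (P : Fin n → Bool) where

  ∈-filterᵇ-allFin⁺ : ∀ {k} → P k ≡ true → k ∈ filterᵇ P (allFin n)
  ∈-filterᵇ-allFin⁺ {k} Pk = ∈-filter⁺ (λ w → T? (P w)) (∈-allFin k) (Equivalence.from T-≡ Pk)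

  ∈-filterᵇ-allFin⁻ : ∀ {k} → k ∈ filterᵇ P (allFin n) → P k ≡ true
  ∈-filterᵇ-allFin⁻ k∈ = Equivalence.to T-≡ (proj₂ (∈-filter⁻ (λ w → T? (P w)) {xs = allFin n} k∈))

  filterᵇ-allFin-unique : Unique (filterᵇ P (allFin n))
  filterᵇ-allFin-unique = Unique.filter⁺ (λ w → T? (P w)) (Unique.allFin⁺ n)

card≥2⇒∃≢ : (S : Fin n → Bool) → 2 ≤ card S → ∀ v → ∃[ k ] S k ≡ true × k ≢ v
card≥2⇒∃≢ S |S|≥2 v with Unique-length≥2⇒∃≢ _ (filterᵇ-allFin-unique S) |S|≥2 v
... | k , k∈S , k≢v = k , ∈-filterᵇ-allFin⁻ S k∈S , k≢v

card≥2⇒nonempty : (S : Fin n → Bool) → 2 ≤ card S → ∃[ k ] S k ≡ true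
card≥2⇒nonempty S |S|≥2 with filterᵇ S (allFin _) | ∈-filterᵇ-allFin⁻ S
... | k ∷ _ | ∈⇒S = k , ∈⇒S (here refl)

module _ (A : Adjacency n) where

  degree≡1⇒unique-neighbour : ∀ {x a b} → degree A x ≡ 1 → A x a ≡ true → A x b ≡ true → a ≡ b
  degree≡1⇒unique-neighbour {x} deg xa xb =
    length≡1⇒members-equal (neighbours A x) deg (∈-filterᵇ-allFin⁺ (A x) xa) (∈-filterᵇ-allFin⁺ (A x) xb)

  unique-neighbour⇒degree≡1 : ∀ {x k} → (∀ {w} → A x w ≡ true → w ≡ k) → A x k ≡ true → degree A x ≡ 1
  unique-neighbour⇒degree≡1 {x} only-k xk =
    Unique-constant⇒length≡1 (neighbours A x) (filterᵇ-allFin-unique (A x))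
      (λ w∈ → only-k (∈-filterᵇ-allFin⁻ (A x) w∈)) (∈-filterᵇ-allFin⁺ (A x) xk)

module _ {A : Adjacency n} where

  infixr 5 _++ʷ_

  _++ʷ_ : ∀ {u v w} → Walk A u v → Walk A v w → Walk A u w
  []      ++ʷ q = q
  (e ∷ p) ++ʷ q = e ∷ (p ++ʷ q)

  len-++ʷ : ∀ {u v w} (p : Walk A u v) (q : Walk A v w) → len (p ++ʷ q) ≡ len p + len q
  len-++ʷ []      q = refl
  len-++ʷ (e ∷ p) q = cong suc (len-++ʷ p q)

  support-∷ʳ : ∀ {u v w} (p : Walk A u v) (e : A v w ≡ true) → support (p ++ʷ (e ∷ [])) ≡ support p ∷ʳ w
  support-∷ʳ         []      e = refl
  support-∷ʳ {u = u} (_ ∷ p) e = cong (u ∷_) (support-∷ʳ p e)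

  start∈support : ∀ {u v} (p : Walk A u v) → u ∈ support p
  start∈support []      = here refl
  start∈support (_ ∷ _) = here refl

  end∈support : ∀ {u v} (p : Walk A u v) → v ∈ support p
  end∈support []      = here refl
  end∈support (_ ∷ p) = there (end∈support p)

  module _ (A-sym : ∀ u v → A u v ≡ A v u) where

    reverseʷ : ∀ {u v} → Walk A u v → Walk A v u
    reverseʷ []                    = []
    reverseʷ (_∷_ {u} {v} e p) = reverseʷ p ++ʷ (trans (A-sym v u) e ∷ [])

    len-reverseʷ : ∀ {u v} (p : Walk A u v) → len (reverseʷ p) ≡ len p
    len-reverseʷ []      = refl
    len-reverseʷ (e ∷ p) =
      trans (len-++ʷ (reverseʷ p) _) (trans (+-comm (len (reverseʷ p)) 1) (cong suc (len-reverseʷ p)))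

    support-reverseʷ : ∀ {u v} (p : Walk A u v) → support (reverseʷ p) ≡ reverse (support p)
    support-reverseʷ []                    = refl
    support-reverseʷ (_∷_ {u} {v} e p) = begin
      support (reverseʷ p ++ʷ _ ∷ [])   ≡⟨ support-∷ʳ (reverseʷ p) _ ⟩
      support (reverseʷ p) ∷ʳ u         ≡⟨ cong (_∷ʳ u) (support-reverseʷ p) ⟩
      reverse (support p) ∷ʳ u          ≡⟨ unfold-reverse u (support p) ⟨
      reverse (u ∷ support p)           ∎
      where open ≡-Reasoning

    IsPath-reverseʷ : ∀ {u v} {p : Walk A u v} → IsPath p → IsPath (reverseʷ p)
    IsPath-reverseʷ {p = p} path = subst Unique (sym (support-reverseʷ p))
      (Unique-resp-↭ (↭-sym (↭-reverse (support p))) path)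
      where
      open Permutation (setoid (Fin n)) using (↭-sym)
      open PermutationProperties (setoid (Fin n)) using (Unique-resp-↭; ↭-reverse)

mapʷ : ∀ {A B : Adjacency n} → SubgraphOf A B → ∀ {u v} → Walk A u v → Walk B u v
mapʷ A⊆B []                = []
mapʷ A⊆B (_∷_ {u} {v} e p) = A⊆B u v e ∷ mapʷ A⊆B p

even-walk : {A : Adjacency n} (colour : Fin n → Bool) →
            (∀ {x y} → A x y ≡ true → colour y ≡ not (colour x)) →
            ∀ {x z} (q : Walk A x z) → colour x ≡ colour z → len q % 2 ≡ 0
even-walk colour proper []                    _    = refl
even-walk colour proper (e ∷ [])              same = contradiction (trans same (proper e)) (not-¬ refl)
even-walk colour proper (_∷_ {x} e (_∷_ {v = y′} e′ q)) same =
  even-walk colour proper q (trans two-steps same)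
  where
  two-steps : colour y′ ≡ colour x
  two-steps = trans (proper e′) (trans (cong not (proper e)) (not-involutive (colour x)))

module ParentPointerTree (H : Adjacency n) (H-sym : ∀ u v → H u v ≡ H v u) (root : Fin n)
  (rank : Fin n → ℕ)
  (descend : ∀ v → v ≢ root → ∃[ w ] H v w ≡ true × rank w < rank v) where

  parent : Fin n → Fin n
  parent v with v ≟ᶠ root
  ... | yes _   = v
  ... | no  v≢r = proj₁ (descend v v≢r)

  parent-descends : ∀ v → v ≢ root → H v (parent v) ≡ true × rank (parent v) < rank v
  parent-descends v v≢r with v ≟ᶠ root
  ... | yes v≡r = contradiction v≡r v≢r
  ... | no  v≢r = proj₂ (descend v v≢r)

  ChildOf : Fin n → Fin n → Set
  ChildOf u v = u ≢ root × parent u ≡ v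

  childOf? : ∀ u v → Dec (ChildOf u v)
  childOf? u v = ¬? (u ≟ᶠ root) ×-dec (parent u ≟ᶠ v)

  ChildOf⇒rank< : ∀ {u v} → ChildOf u v → rank v < rank u
  ChildOf⇒rank< (u≢r , refl) = proj₂ (parent-descends _ u≢r)

  tree : Adjacency n
  tree u v = does (childOf? u v ⊎-dec childOf? v u)

  tree-edge⁻ : ∀ u v → tree u v ≡ true → ChildOf u v ⊎ ChildOf v u
  tree-edge⁻ u v = witness (childOf? u v ⊎-dec childOf? v u)

  tree-edge⁺ : ∀ {u v} → ChildOf u v ⊎ ChildOf v u → tree u v ≡ true
  tree-edge⁺ {u} {v} = dec-true (childOf? u v ⊎-dec childOf? v u)

  tree-sym : ∀ u v → tree u v ≡ tree v u
  tree-sym u v = ∨-comm (does (childOf? u v)) (does (childOf? v u))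

  tree-irrefl : ∀ u → tree u u ≡ false
  tree-irrefl u = dec-false (childOf? u u ⊎-dec childOf? u u) λ where
    (inj₁ uu) → <-irrefl refl (ChildOf⇒rank< uu)
    (inj₂ uu) → <-irrefl refl (ChildOf⇒rank< uu)

  tree⊆H : SubgraphOf tree H
  tree⊆H u v uv with tree-edge⁻ u v uv
  ... | inj₁ (u≢r , refl) = proj₁ (parent-descends u u≢r)
  ... | inj₂ (v≢r , refl) = trans (H-sym u v) (proj₁ (parent-descends v v≢r))

  walk-to-root : ∀ v → Acc _<_ (rank v) → Walk tree v root
  walk-to-root v (acc smaller) with v ≟ᶠ root
  ... | yes refl = []
  ... | no  v≢r  =
    tree-edge⁺ (inj₁ (v≢r , refl)) ∷ walk-to-root (parent v) (smaller (proj₂ (parent-descends v v≢r)))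

  tree-connected : Connected tree
  tree-connected u v =
    walk-to-root u (<-wellFounded _) ++ʷ reverseʷ tree-sym (walk-to-root v (<-wellFounded _))

  -- leaving x other than through its parent, each step goes to a child, so the rank increases
  rank-increases : ∀ {x z} (q : Walk tree x z) → Unique (parent x ∷ support q) → rank x + len q ≤ rank z
  rank-increases {x} [] _ = ≤-reflexive (+-identityʳ (rank x))
  rank-increases {x} (_∷_ {v = y} e q) (parent∉ ∷ unique) with tree-edge⁻ x y e
  ... | inj₁ (_ , refl) = contradiction refl (All.lookup parent∉ (there (start∈support q)))
  ... | inj₂ y↑x@(_ , refl) = begin
    rank x + suc (len q) ≡⟨ +-suc (rank x) (len q) ⟩
    suc (rank x) + len q ≤⟨ +-monoˡ-≤ (len q) (ChildOf⇒rank< y↑x) ⟩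
    rank y + len q       ≤⟨ rank-increases q unique ⟩
    _                    ∎
    where open ≤-Reasoning

  -- the second vertex y of such a path is not the parent b of a, so it is a child of a,
  -- and the rank can only grow on the way from y back to b
  no-path-closing-at-parent : ∀ {a b} (c : Walk tree a b) → IsPath c → 2 ≤ len c → ChildOf a b → ⊥
  no-path-closing-at-parent (_ ∷ []) _ (s≤s ()) _
  no-path-closing-at-parent {a} {b} (_∷_ {v = y} e c@(_ ∷ c′)) path@(_ ∷ (y∉ ∷ _)) _ a↑b@(_ , refl)
    with tree-edge⁻ a y e
  ... | inj₁ (_ , refl) = All.lookup y∉ (end∈support c′) refl
  ... | inj₂ y↑a@(_ , refl) = <-irrefl refl (begin-strict
    rank b           <⟨ ChildOf⇒rank< a↑b ⟩
    rank a           <⟨ ChildOf⇒rank< y↑a ⟩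
    rank y           ≤⟨ m≤m+n (rank y) (len c) ⟩
    rank y + len c   ≤⟨ rank-increases c path ⟩
    rank b           ∎)
    where open ≤-Reasoning

  tree-acyclic : Acyclic tree
  tree-acyclic (u , v , c , path , long , uv) with tree-edge⁻ u v uv
  ... | inj₂ v↑u = no-path-closing-at-parent c path long v↑u
  ... | inj₁ u↑v = no-path-closing-at-parent (reverseʷ tree-sym c) (IsPath-reverseʷ tree-sym path)
                     (subst (2 ≤_) (sym (len-reverseʷ tree-sym c)) long) u↑v

  tree-isTree : IsTree tree
  tree-isTree = (tree-sym , tree-irrefl) , tree-connected , tree-acyclic

module Distance (H : Adjacency n) (root : Fin n) where

  Within : ℕ → Fin n → Set
  Within zero    v = v ≡ root
  Within (suc k) v = Within k v ⊎ ∃[ w ] H v w ≡ true × Within k w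

  within? : ∀ k → Decidable (Within k)
  within? zero    v = v ≟ᶠ root
  within? (suc k) v = within? k v ⊎-dec any? (λ w → (H v w ≟ᵇ true) ×-dec within? k w)

  walk⇒within : ∀ {v} (q : Walk H v root) → Within (len q) v
  walk⇒within []                = refl
  walk⇒within (_∷_ {v = w} e q) = inj₂ (w , e , walk⇒within q)

  module _ (H-connected : Connected H) where

    distance : Fin n → ℕ
    distance v = least (λ k → within? k v) (len (H-connected v root))

    distance-within : ∀ v → Within (distance v) v
    distance-within v = least-satisfies (λ k → within? k v) _ (walk⇒within (H-connected v root))

    distance-minimal : ∀ v {k} → Within k v → distance v ≤ k
    distance-minimal v = least-minimal (λ k → within? k v) (len (H-connected v root))

    distance-descends : ∀ v → v ≢ root → ∃[ w ] H v w ≡ true × distance w < distance v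
    distance-descends v v≢r with distance v | distance-within v | distance-minimal v
    ... | zero  | v≡r                  | _       = contradiction v≡r v≢r
    ... | suc k | inj₁ within-k          | minimal = contradiction (minimal within-k) (<-irrefl refl)
    ... | suc k | inj₂ (w , e , within-w) | _      = w , e , s≤s (distance-minimal w within-w)

connected⇒spanning-tree : (H : Adjacency n) → (∀ u v → H u v ≡ H v u) → Connected H → Fin n →
                          ∃[ T ] SubgraphOf T H × IsTree T
connected⇒spanning-tree H H-sym H-connected root = tree , tree⊆H , tree-isTree
  where
  open Distance H root
  open ParentPointerTree H H-sym root (distance H-connected) (distance-descends H-connected)

module Pendant {G T : Adjacency n} (G-irrefl : ∀ u → G u u ≡ false)
  (T⊆G : SubgraphOf T G) (T-connected : Connected T) where

  pendant-edge-in-T : ∀ {l k} → degree G l ≡ 1 → G l k ≡ true → T l k ≡ true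
  pendant-edge-in-T {l} {k} deg lk with T-connected l k
  ... | []                = contradiction (trans (sym (G-irrefl l)) lk) λ ()
  ... | _∷_ {v = y} ly _ with degree≡1⇒unique-neighbour G deg (T⊆G l y ly) lk
  ...   | refl = ly

  pendant-is-leaf : ∀ {l k} → degree G l ≡ 1 → G l k ≡ true → Leaf T l
  pendant-is-leaf {l} deg lk = unique-neighbour⇒degree≡1 T
    (λ {w} lw → degree≡1⇒unique-neighbour G deg (T⊆G l w lw) lk) (pendant-edge-in-T deg lk)

  -- a walk from v to z ∉ {v, l} may enter l, but only to bounce back to v
  exit-avoiding-pendant : ∀ {l v z} → degree G l ≡ 1 → G l v ≡ true → Walk T v z → z ≢ v → z ≢ l →
                          ∃[ w ] T v w ≡ true × w ≢ l
  exit-avoiding-pendant deg lv [] z≢v _ = contradiction refl z≢v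
  exit-avoiding-pendant {l} deg lv (_∷_ {v = y} vy q) z≢v z≢l with y ≟ᶠ l
  ... | no y≢l = y , vy , y≢l
  exit-avoiding-pendant deg lv (_ ∷ []) z≢v z≢l | yes refl = contradiction refl z≢l
  exit-avoiding-pendant {l} deg lv (_ ∷ (_∷_ {v = y′} ly′ q)) z≢v z≢l | yes refl
    with degree≡1⇒unique-neighbour G deg (T⊆G l y′ ly′) lv
  ... | refl = exit-avoiding-pendant deg lv q z≢v z≢l

  attachment-of-pendant-is-not-leaf : (∀ u v → T u v ≡ T v u) → ∀ {l v z} →
    degree G l ≡ 1 → G l v ≡ true → z ≢ v → z ≢ l → ¬ Leaf T v
  attachment-of-pendant-is-not-leaf T-sym {l} {v} {z} deg lv z≢v z≢l leaf
    with exit-avoiding-pendant deg lv (T-connected v z) z≢v z≢l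
  ... | w , vw , w≢l =
    w≢l (sym (degree≡1⇒unique-neighbour T leaf (trans (T-sym v l) (pendant-edge-in-T deg lv)) vw))

module SplitGraph (G : Adjacency n) (inK : Fin n → Bool) (G-simple : IsSimpleGraph G)
  (I-independent : Independent G (λ v → not (inK v)))
  (K≡N[I₁] : ∀ v → inK v ≡ true ⇔ InNbhd G (λ u → not (inK u) ∧ (degree G u ≡ᵇ 1)) v)
  (|K|≥2 : 2 ≤ card inK) where

  Ĝ : Adjacency n
  Ĝ = removeKEdges G inK

  K≢I : ∀ {x y} → inK x ≡ true → inK y ≡ false → x ≢ y
  K≢I x∈K y∈I refl = contradiction (trans (sym x∈K) y∈I) λ ()

  pendant : ∀ {v} → inK v ≡ true → ∃[ l ] inK l ≡ false × degree G l ≡ 1 × G l v ≡ true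
  pendant {v} v∈K with Equivalence.to (K≡N[I₁] v) v∈K
  ... | _ , l , l∈I₁ , lv with ∧-true l∈I₁
  ...   | l∈I , deg = l , not-injective l∈I , ≡ᵇ⇒≡ _ 1 (Equivalence.from T-≡ deg) , lv

  Ĝ-sym : ∀ u v → Ĝ u v ≡ Ĝ v u
  Ĝ-sym u v = cong₂ _∧_ (proj₁ G-simple u v) (cong not (∧-comm (inK u) (inK v)))

  Ĝ⊆G : SubgraphOf Ĝ G
  Ĝ⊆G u v uv = proj₁ (∧-true uv)

  Ĝ-bipartite : ∀ {x y} → Ĝ x y ≡ true → inK y ≡ not (inK x)
  Ĝ-bipartite {x} {y} xy with inK x in x∈ | inK y in y∈ | G x y in gxy
  ... | true  | false | _     = refl
  ... | false | true  | _     = refl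
  ... | true  | true  | true  = contradiction xy λ ()
  ... | _     | _     | false = contradiction xy λ ()
  ... | false | false | true  =
    contradiction (trans (sym gxy) (I-independent x y (cong not x∈) (cong not y∈))) λ ()

  K-vertex-is-not-leaf : ∀ {T} → SubgraphOf T G → (∀ u v → T u v ≡ T v u) → Connected T →
                         ∀ {v} → inK v ≡ true → ¬ Leaf T v
  K-vertex-is-not-leaf T⊆G T-sym T-connected v∈K with pendant v∈K | card≥2⇒∃≢ inK |K|≥2 _
  ... | l , l∈I , deg , lv | k , k∈K , k≢v =
    attachment-of-pendant-is-not-leaf T-sym deg lv k≢v (K≢I k∈K l∈I)
    where open Pendant (proj₂ G-simple) T⊆G T-connected

  even-tree-avoids-K-edges : ∀ {T} → SubgraphOf T G → IsEvenTree T →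
                             ∀ {x y} → T x y ≡ true → inK x ≡ true → inK y ≡ true → ⊥
  even-tree-avoids-K-edges {T} T⊆G (((T-sym , T-irrefl) , T-connected , _) , even) {x} {y} xy x∈K y∈K
    with pendant x∈K | pendant y∈K
  ... | lx , lx∈I , deg-lx , lx-x | ly , ly∈I , deg-ly , ly-y =
    contradiction
      (even lx ly lx≢ly (pendant-is-leaf deg-lx lx-x) (pendant-is-leaf deg-ly ly-y) lx-x-y-ly path) λ ()
    where
    open Pendant (proj₂ G-simple) T⊆G T-connected
    x≢y : x ≢ y
    x≢y refl = contradiction (trans (sym (T-irrefl x)) xy) λ ()
    lx≢ly : lx ≢ ly
    lx≢ly refl = x≢y (degree≡1⇒unique-neighbour G deg-lx lx-x ly-y)
    lx-x-y-ly : Walk T lx ly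
    lx-x-y-ly =
      pendant-edge-in-T deg-lx lx-x ∷ xy ∷ trans (T-sym y ly) (pendant-edge-in-T deg-ly ly-y) ∷ []
    path : IsPath lx-x-y-ly
    path = (K≢I x∈K lx∈I ∘ sym ∷ K≢I y∈K lx∈I ∘ sym ∷ lx≢ly ∷ [])
         ∷ (x≢y ∷ K≢I x∈K ly∈I ∷ [])
         ∷ (K≢I y∈K ly∈I ∷ [])
         ∷ [] ∷ []

  even-tree⇒Ĝ-connected : HasSpanningEvenTree G → Connected Ĝ
  even-tree⇒Ĝ-connected (T , T⊆G , even-tree@((_ , T-connected , _) , _)) u v =
    mapʷ T⊆Ĝ (T-connected u v)
    where
    T⊆Ĝ : SubgraphOf T Ĝ
    T⊆Ĝ x y xy with T⊆G x y xy | inK x in x∈ | inK y in y∈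
    ... | gxy | true  | true  = contradiction (even-tree-avoids-K-edges T⊆G even-tree xy x∈ y∈) λ ()
    ... | gxy | true  | false = cong (_∧ true) gxy
    ... | gxy | false | _     = cong (_∧ true) gxy

  Ĝ-connected⇒even-tree : Connected Ĝ → HasSpanningEvenTree G
  Ĝ-connected⇒even-tree Ĝ-connected
    with connected⇒spanning-tree Ĝ Ĝ-sym Ĝ-connected (proj₁ (card≥2⇒nonempty inK |K|≥2))
  ... | T , T⊆Ĝ , T-tree@((T-sym , _) , T-connected , _) = T , T⊆G , T-tree , leaves-even
    where
    T⊆G : SubgraphOf T G
    T⊆G u v uv = Ĝ⊆G u v (T⊆Ĝ u v uv)
    leaf∈I : ∀ {u} → Leaf T u → inK u ≡ false
    leaf∈I {u} leaf with inK u in u∈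
    ... | true  = contradiction leaf (K-vertex-is-not-leaf T⊆G T-sym T-connected u∈)
    ... | false = refl
    leaves-even : ∀ u v → u ≢ v → Leaf T u → Leaf T v → (q : Walk T u v) → IsPath q → len q % 2 ≡ 0
    leaves-even u v _ u-leaf v-leaf q _ =
      even-walk inK (λ {x} {y} xy → Ĝ-bipartite (T⊆Ĝ x y xy)) q
        (trans (leaf∈I u-leaf) (sym (leaf∈I v-leaf)))

lemma8 : (n : ℕ) (G : Adjacency n) (inK : Fin n → Bool) →
         IsSimpleGraph G → Connected G →
         Clique G inK → MaximalIndependent G (λ v → not (inK v)) →
         (∀ v → inK v ≡ true ⇔ InNbhd G (λ u → not (inK u) ∧ (degree G u ≡ᵇ 1)) v) →
         2 ≤ card inK →
         (HasSpanningEvenTree G ⇔ Connected (removeKEdges G inK))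
lemma8 n G inK simple _ _ (I-independent , _) K≡N[I₁] |K|≥2 =
  mk⇔ even-tree⇒Ĝ-connected Ĝ-connected⇒even-tree
  where open SplitGraph G inK simple I-independent K≡N[I₁] |K|≥2
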